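{- There exists a family $(D^n)_{n\in\mathbb{N}_{>0}}$ of $n\times n$ distance matrices such that each $D^n$ is $\mathrm{Fo}$-realizable, and every temporal graph $\mathcal{G}=(G,\lambda)$ with $\mathrm{Fo}(\mathcal{G})=D^n$ has at least one edge $e$ with $|\lambda(e)|=\Omega(n)$.
   Context: A temporal graph $\mathcal{G}=(G,\lambda)$ consists of a static undirected graph $G=(V,E)$ with $V=[n]$ and a labeling $\lambda:E\to 2^{\mathbb{N}_{>0}}$ assigning to each edge the (finite) set of positive times at which it appears. A strict temporal $uv$-path is a path $u=v_0,\dots,v_k=v$ in $G$ with distinct vertices and times $\tau_1<\dots<\tau_k$, $\tau_i\in\lambda(\{v_{i-1},v_i\})$; its arrival time is $\tau_k$. $\mathrm{Fo}(\mathcal{G})$ is the $n\times n$ matrix with diagonal $0$ and off-diagonal entry $(u,v)$ equal to the minimum arrival time of a strict temporal $uv$-path ($\infty$ if none). A distance matrix is an $n\times n$ matrix with entries in $\mathbb{N}\cup\{\infty\}$ that is $0$ exactly on the diagonal; it is $\mathrm{Fo}$-realizable if $D=\mathrm{Fo}(\mathcal{G})$ for some temporal graph $\mathcal{G}$ on $[n]$. -}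

module Defs where

open import Data.Nat using (ℕ; zero; suc; _<_; _≤_; _*_)
open import Data.Fin using (Fin)
open import Data.Bool using (Bool; true)
open import Data.List using (List; []; _∷_; length)
open import Data.List.Membership.Propositional using (_∈_)
open import Data.List.Relation.Unary.All using (All)
open import Data.List.Relation.Unary.Unique.Propositional using (Unique)
open import Data.Product using (Σ; ∃; ∃-syntax; _×_; _,_)
open import Relation.Binary.PropositionalEquality using (_≡_; _≢_)
open import Relation.Nullary using (¬_)

data ℕ∞ : Set where
  fin : ℕ → ℕ∞
  ∞   : ℕ∞

Matrix : ℕ → Set
Matrix n = Fin n → Fin n → ℕ∞

IsDistanceMatrix : (n : ℕ) → Matrix n → Set
IsDistanceMatrix n D =
  (∀ u → D u u ≡ fin 0) × (∀ u v → D u v ≡ fin 0 → u ≡ v)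

-- G is given by a symmetric irreflexive adjacency relation; the label set
-- λ({u,v}) of an edge is a duplicate-free list of positive naturals
-- (a finite subset of ℕ_{>0}), the same for both orientations.
record TemporalGraph (n : ℕ) : Set where
  field
    adj        : Fin n → Fin n → Bool
    adj-sym    : ∀ u v → adj u v ≡ adj v u
    adj-irrefl : ∀ u → ¬ (adj u u ≡ true)
    label      : Fin n → Fin n → List ℕ
    label-sym  : ∀ u v → label u v ≡ label v u
    label-uniq : ∀ u v → Unique (label u v)
    label-pos  : ∀ u v → All (0 <_) (label u v)
open TemporalGraph public

-- TWalk G u lo v a vs : a walk u = v₀, v₁, …, v_k = v (k ≥ 1) listed as vs,
-- with times τ₁ < … < τ_k, lo < τ₁, τ_i ∈ λ({v_{i-1}, v_i}), arrival τ_k = a.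
data TWalk {n : ℕ} (G : TemporalGraph n) :
     Fin n → ℕ → Fin n → ℕ → List (Fin n) → Set where
  last : ∀ {u v lo τ} → adj G u v ≡ true → τ ∈ label G u v → lo < τ →
         TWalk G u lo v τ (u ∷ v ∷ [])
  step : ∀ {u w v lo τ a vs} → adj G u w ≡ true → τ ∈ label G u w → lo < τ →
         TWalk G w τ v a vs → TWalk G u lo v a (u ∷ vs)

StrictTPath : {n : ℕ} → TemporalGraph n → Fin n → Fin n → ℕ → Set
StrictTPath G u v a = Σ (List _) λ vs → TWalk G u 0 v a vs × Unique vs

IsFo : {n : ℕ} → TemporalGraph n → Matrix n → Set
IsFo {n} G D =
  (∀ u → D u u ≡ fin 0) ×
  (∀ u v → u ≢ v →
     (∀ t → D u v ≡ fin t →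
        StrictTPath G u v t × (∀ a → StrictTPath G u v a → t ≤ a)) ×
     (D u v ≡ ∞ → ∀ a → ¬ StrictTPath G u v a))

FoRealizable : (n : ℕ) → Matrix n → Set
FoRealizable n D = Σ (TemporalGraph n) λ G → IsFo G D

{-# OPTIONS --safe #-}
-- The matrix is Fo of a graph G₀ with two hubs a, b and, for every round j,
-- a leaf uⱼ joined to a at time 3j+1 and a leaf vⱼ joined to b at time 3j+2,
-- the hubs being joined at all times 3j+3.  Let G realize the same matrix.
-- Nothing is reachable from vⱼ before time 3j+2, so a foremost path from vⱼ
-- to b is the single edge vⱼb at time 3j+2.  A foremost path from uⱼ to b
-- arrives at 3j+3; its last edge cannot be uⱼb (then vⱼ would reach uⱼ
-- through b, although uⱼ is unreachable from vⱼ), and it cannot start at a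
-- vertex other than a, because every vertex except a is reached from uⱼ no
-- earlier than 3j+3.  Hence the edge ab carries all labels 3j+3, one for
-- each of the ⌊(n−2)/2⌋ rounds, and 4⌊(n−2)/2⌋ ≥ n once n ≥ 6.
module Submission where

open import Defs
open import Data.Nat using (ℕ; zero; suc; _+_; _*_; _<_; _≤_; z≤n; s≤s; z<s; _<?_; ⌊_/2⌋)
open import Data.Nat.Properties hiding (_≟_)
open import Data.Fin using (Fin; zero; suc; toℕ; fromℕ<; _≟_)
open import Data.Fin.Properties using (toℕ<n; toℕ-injective; toℕ-fromℕ<; injective⇒≤)
open import Data.Bool using (true; not; if_then_else_)
open import Data.List using (List; []; _∷_; _∷ʳ_; length; lookup; null; applyUpTo)
open import Data.List.Membership.Propositional using (_∈_)
open import Data.List.Membership.Propositional.Properties using (∈-applyUpTo⁺; ∈-applyUpTo⁻)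
open import Data.List.Relation.Unary.Any using (here; there; index)
open import Data.List.Relation.Unary.Any.Properties using (lookup-index)
open import Data.List.Relation.Unary.All as All using (All; []; _∷_)
import Data.List.Relation.Unary.All.Properties as All
open import Data.List.Relation.Unary.AllPairs using ([]; _∷_)
open import Data.List.Relation.Unary.Unique.Propositional using (Unique)
import Data.List.Relation.Unary.Unique.Propositional.Properties as Unique
open import Data.Product using (Σ; ∃-syntax; _×_; _,_; proj₁; proj₂)
open import Data.Sum using (_⊎_; inj₁; inj₂)
open import Data.Empty using (⊥; ⊥-elim)
open import Function using (_∘_)
open import Relation.Nullary using (¬_; Dec; yes; no; does)
open import Relation.Binary.PropositionalEquality
  using (_≡_; _≢_; refl; sym; trans; cong; subst; subst₂; module ≡-Reasoning)

_≤∞_ : ℕ∞ → ℕ → Set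
fin d ≤∞ a = d ≤ a
∞     ≤∞ a = ⊥

fin-injective : ∀ {d e} → fin d ≡ fin e → d ≡ e
fin-injective refl = refl

Unique-∷ʳ⁻ : ∀ {A : Set} {xs : List A} {x} → Unique (xs ∷ʳ x) → Unique xs
Unique-∷ʳ⁻ {xs = []}     _          = []
Unique-∷ʳ⁻ {xs = _ ∷ _} (y∉ ∷ uniq) = proj₁ (All.∷ʳ⁻ y∉) ∷ Unique-∷ʳ⁻ uniq

injective-members⇒≤length : ∀ {A : Set} {f : ℕ → A} {k} (xs : List A) →
  (∀ {i j} → f i ≡ f j → i ≡ j) → (∀ {j} → j < k → f j ∈ xs) → k ≤ length xs
injective-members⇒≤length {f = f} xs f-injective member = injective⇒≤ position-injective
  where
  position : Fin _ → Fin (length xs)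
  position i = index (member (toℕ<n i))

  position-injective : ∀ {i j} → position i ≡ position j → i ≡ j
  position-injective {i} {j} eq = toℕ-injective (f-injective (begin
    f (toℕ i)               ≡⟨ lookup-index (member (toℕ<n i)) ⟩
    lookup xs (position i)  ≡⟨ cong (lookup xs) eq ⟩
    lookup xs (position j)  ≡⟨ lookup-index (member (toℕ<n j)) ⟨
    f (toℕ j)               ∎))
    where open ≡-Reasoning

-- Temporal paths

module _ {n : ℕ} (G : TemporalGraph n) where

  record Hop (x y : Fin n) (τ : ℕ) : Set where
    constructor hop
    field
      adjacent : adj G x y ≡ true
      labelled : τ ∈ label G x y

  Hop-sym : ∀ {x y τ} → Hop x y τ → Hop y x τ
  Hop-sym {x} {y} (hop e l) = hop (trans (adj-sym G y x) e) (subst (_ ∈_) (label-sym G x y) l)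

  Hop⇒≢ : ∀ {x y τ} → Hop x y τ → x ≢ y
  Hop⇒≢ (hop e _) refl = adj-irrefl G _ e

  Hop⇒0< : ∀ {x y τ} → Hop x y τ → 0 < τ
  Hop⇒0< {x} {y} (hop _ l) = All.lookup (label-pos G x y) l

  path₁ : ∀ {x y τ} → Hop x y τ → StrictTPath G x y τ
  path₁ h@(hop e l) = _ , last e l (Hop⇒0< h) , (Hop⇒≢ h ∷ []) ∷ [] ∷ []

  path₂ : ∀ {x y z τ₁ τ₂} → x ≢ z → Hop x y τ₁ → Hop y z τ₂ → τ₁ < τ₂ →
          StrictTPath G x z τ₂
  path₂ x≢z h₁@(hop e₁ l₁) h₂@(hop e₂ l₂) τ₁<τ₂ =
    _ , step e₁ l₁ (Hop⇒0< h₁) (last e₂ l₂ τ₁<τ₂) ,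
    (Hop⇒≢ h₁ ∷ x≢z ∷ []) ∷ (Hop⇒≢ h₂ ∷ []) ∷ [] ∷ []

  path₃ : ∀ {x y z w τ₁ τ₂ τ₃} → x ≢ z → x ≢ w → y ≢ w →
          Hop x y τ₁ → Hop y z τ₂ → Hop z w τ₃ → τ₁ < τ₂ → τ₂ < τ₃ →
          StrictTPath G x w τ₃
  path₃ x≢z x≢w y≢w h₁@(hop e₁ l₁) h₂@(hop e₂ l₂) h₃@(hop e₃ l₃) τ₁<τ₂ τ₂<τ₃ =
    _ , step e₁ l₁ (Hop⇒0< h₁) (step e₂ l₂ τ₁<τ₂ (last e₃ l₃ τ₂<τ₃)) ,
    (Hop⇒≢ h₁ ∷ x≢z ∷ x≢w ∷ []) ∷ (Hop⇒≢ h₂ ∷ y≢w ∷ []) ∷ (Hop⇒≢ h₃ ∷ []) ∷ [] ∷ []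

  lo<arrival : ∀ {u lo v a vs} → TWalk G u lo v a vs → lo < a
  lo<arrival (last _ _ lo<τ)      = lo<τ
  lo<arrival (step _ _ lo<τ rest) = <-trans lo<τ (lo<arrival rest)

  walk-last-hop : ∀ {u lo v a vs} → TWalk G u lo v a vs →
    (Hop u v a × vs ≡ u ∷ v ∷ []) ⊎
    ∃[ w ] ∃[ a′ ] ∃[ ws ] (Hop w v a × a′ < a × TWalk G u lo w a′ ws × vs ≡ ws ∷ʳ v)
  walk-last-hop (last e l _) = inj₁ (hop e l , refl)
  walk-last-hop {u} (step e l lo<τ rest) with walk-last-hop rest
  ... | inj₁ (last-hop , refl) = inj₂ (_ , _ , _ , last-hop , lo<arrival rest , last e l lo<τ , refl)
  ... | inj₂ (w , a′ , ws , last-hop , a′<a , prefix , refl) =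
    inj₂ (w , a′ , u ∷ ws , last-hop , a′<a , step e l lo<τ prefix , refl)

  path-last-hop : ∀ {u v a} → StrictTPath G u v a →
    Hop u v a ⊎ ∃[ w ] ∃[ a′ ] (Hop w v a × a′ < a × StrictTPath G u w a′)
  path-last-hop (_ , walk , uniq) with walk-last-hop walk
  ... | inj₁ (last-hop , _) = inj₁ last-hop
  ... | inj₂ (w , a′ , ws , last-hop , a′<a , prefix , refl) =
    inj₂ (w , a′ , last-hop , a′<a , ws , prefix , Unique-∷ʳ⁻ uniq)

  Closed : (Fin n → ℕ∞) → Set
  Closed d = ∀ {x y lo τ} → τ ∈ label G x y → d x ≤∞ lo → lo < τ → d y ≤∞ τ

  Closed⇒walk-bound : ∀ {d} → Closed d →
    ∀ {w lo v a vs} → TWalk G w lo v a vs → d w ≤∞ lo → d v ≤∞ a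
  Closed⇒walk-bound closed (last _ l lo<τ)      dw = closed l dw lo<τ
  Closed⇒walk-bound closed (step _ l lo<τ rest) dw =
    Closed⇒walk-bound closed rest (closed l dw lo<τ)

  IsFo-intro : ∀ {D : Matrix n} → (∀ u → D u u ≡ fin 0) → (∀ u → Closed (D u)) →
    (∀ {u v t} → u ≢ v → D u v ≡ fin t → StrictTPath G u v t) → IsFo G D
  IsFo-intro {D} diag closed path = diag , λ u v u≢v →
    (λ t eq → path u≢v eq , λ a P → subst (_≤∞ a) eq (bound P)) ,
    (λ eq a P → subst (_≤∞ a) eq (bound P))
    where
    bound : ∀ {u v a} → StrictTPath G u v a → D u v ≤∞ a
    bound {u} (_ , walk , _) =
      Closed⇒walk-bound (closed u) walk (subst (_≤∞ 0) (sym (diag u)) z≤n)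

  module _ {D : Matrix n} (fo : IsFo G D) where

    IsFo⇒path : ∀ {u v t} → u ≢ v → D u v ≡ fin t → StrictTPath G u v t
    IsFo⇒path {u} {v} u≢v eq = proj₁ (proj₁ (proj₂ fo u v u≢v) _ eq)

    IsFo⇒bound : ∀ {u v a} → u ≢ v → StrictTPath G u v a → D u v ≤∞ a
    IsFo⇒bound {u} {v} u≢v P with D u v in eq
    ... | fin t = proj₂ (proj₁ (proj₂ fo u v u≢v) t eq) _ P
    ... | ∞     = proj₂ (proj₂ fo u v u≢v) eq _ P

    foremost-last-hop : ∀ {u v t} → u ≢ v → D u v ≡ fin t →
      Hop u v t ⊎ ∃[ w ] (u ≢ w × Hop w v t × ∃[ a ] (a < t × D u w ≤∞ a))
    foremost-last-hop {u} u≢v eq with path-last-hop (IsFo⇒path u≢v eq)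
    ... | inj₁ last-hop = inj₁ last-hop
    ... | inj₂ (w , a , last-hop , a<t , prefix) with u ≟ w
    ...   | yes refl = inj₁ last-hop
    ...   | no u≢w   = inj₂ (w , u≢w , last-hop , a , a<t , IsFo⇒bound u≢w prefix)

-- A, B are the hubs a, b; U j and V j are the leaves uⱼ and vⱼ.
data Kind : Set where
  A B : Kind
  U V : ℕ → Kind

code : Kind → ℕ
code A     = 0
code B     = 1
code (U j) = 2 + j * 2
code (V j) = 3 + j * 2

nextRound : Kind → Kind
nextRound (U j) = U (suc j)
nextRound (V j) = V (suc j)
nextRound k     = k

leaf : ℕ → Kind
leaf 0             = U 0
leaf 1             = V 0
leaf (suc (suc m)) = nextRound (leaf m)

kind : ℕ → Kind
kind 0             = A
kind 1             = B
kind (suc (suc m)) = leaf m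

code-leaf : ∀ m → code (leaf m) ≡ 2 + m
code-leaf 0 = refl
code-leaf 1 = refl
code-leaf (suc (suc m)) with leaf m | code-leaf m
... | U _ | eq = cong (2 +_) eq
... | V _ | eq = cong (2 +_) eq
... | A   | ()
... | B   | ()

code-kind : ∀ m → code (kind m) ≡ m
code-kind 0             = refl
code-kind 1             = refl
code-kind (suc (suc m)) = code-leaf m

leaf-U : ∀ j → leaf (j * 2) ≡ U j
leaf-U zero    = refl
leaf-U (suc j) rewrite leaf-U j = refl

leaf-V : ∀ j → leaf (1 + j * 2) ≡ V j
leaf-V zero    = refl
leaf-V (suc j) rewrite leaf-V j = refl

kind-code : ∀ k → kind (code k) ≡ k
kind-code A     = refl
kind-code B     = refl
kind-code (U j) = leaf-U j
kind-code (V j) = leaf-V j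

index<code-U : ∀ j → j < code (U j)
index<code-U j = s≤s (≤-trans (m≤m*n j 2) (n≤1+n _))

module _ {n : ℕ} where

  kindOf : Fin n → Kind
  kindOf x = kind (toℕ x)

  vertex : (k : Kind) → code k < n → Fin n
  vertex k k<n = fromℕ< k<n

  kindOf-injective : ∀ {x y} → kindOf x ≡ kindOf y → x ≡ y
  kindOf-injective {x} {y} eq = toℕ-injective (begin
    toℕ x             ≡⟨ code-kind (toℕ x) ⟨
    code (kindOf x)   ≡⟨ cong code eq ⟩
    code (kindOf y)   ≡⟨ code-kind (toℕ y) ⟩
    toℕ y             ∎)
    where open ≡-Reasoning

  kind-≢ : ∀ {x y k k′} → kindOf x ≡ k → kindOf y ≡ k′ → k ≢ k′ → x ≢ y
  kind-≢ refl refl k≢k′ refl = k≢k′ refl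

  kindOf-vertex : ∀ k (k<n : code k < n) → kindOf (vertex k k<n) ≡ k
  kindOf-vertex k k<n rewrite toℕ-fromℕ< k<n = kind-code k

  code-kindOf< : ∀ x → code (kindOf x) < n
  code-kindOf< x rewrite code-kind (toℕ x) = toℕ<n x

  vertex-kindOf : ∀ x → vertex (kindOf x) (code-kindOf< x) ≡ x
  vertex-kindOf x = toℕ-injective (trans (toℕ-fromℕ< _) (code-kind (toℕ x)))

  vertex-≢ : ∀ {k k′} {k<n : code k < n} {k′<n : code k′ < n} →
             k ≢ k′ → vertex k k<n ≢ vertex k′ k′<n
  vertex-≢ {k} {k′} {k<n} {k′<n} k≢k′ eq =
    k≢k′ (trans (sym (kindOf-vertex k k<n)) (trans (cong kindOf eq) (kindOf-vertex k′ k′<n)))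

-- Round j occupies the times 3j+1 (edge a–uⱼ), 3j+2 (edge b–vⱼ), 3j+3 (edge a–b).
time : ℕ → ℕ → ℕ
time j r = r + j * 3

tU tV tAB : ℕ → ℕ
tU  j = time j 1
tV  j = time j 2
tAB j = time j 3

tAB-mono-≤ : ∀ {i j} → i ≤ j → tAB i ≤ tAB j
tAB-mono-≤ i≤j = +-monoʳ-≤ 3 (*-monoˡ-≤ 3 i≤j)

time<tAB⇒≤ : ∀ i j r → time i r < tAB j → i ≤ j
time<tAB⇒≤ i j r lt = ≤-pred (*-cancelʳ-< 3 i (suc j) (≤-<-trans (m≤n+m (i * 3) r) lt))

tU<tAB : ∀ j → tU j < tAB j
tU<tAB j = +-monoˡ-< (j * 3) (s≤s (s≤s z≤n))

tV<tAB : ∀ j → tV j < tAB j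
tV<tAB j = +-monoˡ-< (j * 3) (s≤s (s≤s (s≤s z≤n)))

tU<tU⇒tAB<tU : ∀ i j → tU i < tU j → tAB i < tU j
tU<tU⇒tAB<tU i j (s≤s 1+3i≤3j) = begin-strict
  tAB i      ≡⟨⟩
  suc i * 3  ≤⟨ *-monoˡ-≤ 3 (*-cancelʳ-< 3 i j 1+3i≤3j) ⟩
  j * 3      <⟨ n<1+n (j * 3) ⟩
  tU j       ∎
  where open ≤-Reasoning

tAB-injective : ∀ {i j} → tAB i ≡ tAB j → i ≡ j
tAB-injective {i} {j} eq = suc-injective (*-cancelʳ-≡ (suc i) (suc j) 3 eq)

-- arrA k and arrB k are the foremost arrival times at the hubs a and b from kind k.
arrA arrB : Kind → ℕ
arrA A     = 0
arrA B     = tAB 0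
arrA (U j) = tU j
arrA (V j) = tAB j
arrB A     = tAB 0
arrB B     = 0
arrB (U j) = tAB j
arrB (V j) = tV j

after : ℕ → ℕ → ℕ∞
after s τ = timeIf (s <? τ) τ
  where
  timeIf : ∀ {P : Set} → Dec P → ℕ → ℕ∞
  timeIf (yes _) τ = fin τ
  timeIf (no _)  _ = ∞

after-reached : ∀ {s τ} → s < τ → after s τ ≤∞ τ
after-reached {s} {τ} s<τ with s <? τ
... | yes _   = ≤-refl
... | no s≮τ = s≮τ s<τ

after-≤∞ : ∀ {s τ a} → after s τ ≤∞ a → s < τ × τ ≤ a
after-≤∞ {s} {τ} h with s <? τ
... | yes s<τ = s<τ , h
... | no _    = ⊥-elim h

after-fin : ∀ s τ {t} → after s τ ≡ fin t → s < τ × τ ≡ t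
after-fin s τ eq with s <? τ | eq
... | yes s<τ | refl = s<τ , refl
... | no _    | ()

-- A leaf is reached at the time of its only edge, provided its hub is reached earlier.
DK : Kind → Kind → ℕ∞
DK k A     = fin (arrA k)
DK k B     = fin (arrB k)
DK k (U j) = after (arrA k) (tU j)
DK k (V j) = after (arrB k) (tV j)

D : (n : ℕ) → Matrix n
D n x y = if does (x ≟ y) then fin 0 else DK (kindOf x) (kindOf y)

D-diag : ∀ {n} (x : Fin n) → D n x x ≡ fin 0
D-diag x with x ≟ x
... | yes _   = refl
... | no x≢x = ⊥-elim (x≢x refl)

D-off : ∀ {n} {x y : Fin n} → x ≢ y → D n x y ≡ DK (kindOf x) (kindOf y)
D-off {x = x} {y} x≢y with x ≟ y
... | yes x≡y = ⊥-elim (x≢y x≡y)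
... | no _    = refl

D-between : ∀ {n} {x y : Fin n} {k k′} → x ≢ y → kindOf x ≡ k → kindOf y ≡ k′ →
            D n x y ≡ DK k k′
D-between x≢y refl refl = D-off x≢y

arrA≡0⇒A : ∀ k → arrA k ≡ 0 → k ≡ A
arrA≡0⇒A A     _ = refl
arrA≡0⇒A B     ()
arrA≡0⇒A (U _) ()
arrA≡0⇒A (V _) ()

arrB≡0⇒B : ∀ k → arrB k ≡ 0 → k ≡ B
arrB≡0⇒B A     ()
arrB≡0⇒B B     _ = refl
arrB≡0⇒B (U _) ()
arrB≡0⇒B (V _) ()

DK≡0⇒≡ : ∀ k k′ → DK k k′ ≡ fin 0 → k ≡ k′
DK≡0⇒≡ k A     eq = arrA≡0⇒A k (fin-injective eq)
DK≡0⇒≡ k B     eq = arrB≡0⇒B k (fin-injective eq)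
DK≡0⇒≡ k (U j) eq with after-fin (arrA k) (tU j) eq
... | _ , ()
DK≡0⇒≡ k (V j) eq with after-fin (arrB k) (tV j) eq
... | _ , ()

D-isDistanceMatrix : ∀ n → IsDistanceMatrix n (D n)
D-isDistanceMatrix n = D-diag , D≡0⇒≡
  where
  D≡0⇒≡ : ∀ x y → D n x y ≡ fin 0 → x ≡ y
  D≡0⇒≡ x y eq with x ≟ y
  ... | yes x≡y = x≡y
  ... | no _    = kindOf-injective (DK≡0⇒≡ _ _ eq)

data Edge (n : ℕ) : Kind → Kind → ℕ → Set where
  ab : ∀ {m} → m < n → Edge n A B (tAB m)
  ba : ∀ {m} → m < n → Edge n B A (tAB m)
  au : ∀ j → Edge n A (U j) (tU j)
  ua : ∀ j → Edge n (U j) A (tU j)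
  bv : ∀ j → Edge n B (V j) (tV j)
  vb : ∀ j → Edge n (V j) B (tV j)

labels : ℕ → Kind → Kind → List ℕ
labels n A     B     = applyUpTo tAB n
labels n B     A     = applyUpTo tAB n
labels n A     (U j) = tU j ∷ []
labels n (U j) A     = tU j ∷ []
labels n B     (V j) = tV j ∷ []
labels n (V j) B     = tV j ∷ []
labels n _     _     = []

Edge⇒∈ : ∀ {n k k′ τ} → Edge n k k′ τ → τ ∈ labels n k k′
Edge⇒∈ (ab m<n) = ∈-applyUpTo⁺ tAB m<n
Edge⇒∈ (ba m<n) = ∈-applyUpTo⁺ tAB m<n
Edge⇒∈ (au _)   = here refl
Edge⇒∈ (ua _)   = here refl
Edge⇒∈ (bv _)   = here refl
Edge⇒∈ (vb _)   = here refl

∈⇒Edge : ∀ {n} k k′ {τ} → τ ∈ labels n k k′ → Edge n k k′ τ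
∈⇒Edge A B mem with ∈-applyUpTo⁻ tAB mem
... | _ , m<n , refl = ab m<n
∈⇒Edge B A mem with ∈-applyUpTo⁻ tAB mem
... | _ , m<n , refl = ba m<n
∈⇒Edge A     (U j) (here refl) = au j
∈⇒Edge (U j) A     (here refl) = ua j
∈⇒Edge B     (V j) (here refl) = bv j
∈⇒Edge (V j) B     (here refl) = vb j
∈⇒Edge A     (U _) (there ())
∈⇒Edge (U _) A     (there ())
∈⇒Edge B     (V _) (there ())
∈⇒Edge (V _) B     (there ())
∈⇒Edge A     A     ()
∈⇒Edge A     (V _) ()
∈⇒Edge B     B     ()
∈⇒Edge B     (U _) ()
∈⇒Edge (U _) B     ()
∈⇒Edge (U _) (U _) ()
∈⇒Edge (U _) (V _) ()
∈⇒Edge (V _) A     ()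
∈⇒Edge (V _) (U _) ()
∈⇒Edge (V _) (V _) ()

Edge⇒0< : ∀ {n k k′ τ} → Edge n k k′ τ → 0 < τ
Edge⇒0< (ab _) = z<s
Edge⇒0< (ba _) = z<s
Edge⇒0< (au _) = z<s
Edge⇒0< (ua _) = z<s
Edge⇒0< (bv _) = z<s
Edge⇒0< (vb _) = z<s

labels-sym : ∀ n k k′ → labels n k k′ ≡ labels n k′ k
labels-sym n A     A     = refl
labels-sym n A     B     = refl
labels-sym n A     (U _) = refl
labels-sym n A     (V _) = refl
labels-sym n B     A     = refl
labels-sym n B     B     = refl
labels-sym n B     (U _) = refl
labels-sym n B     (V _) = refl
labels-sym n (U _) A     = refl
labels-sym n (U _) B     = refl
labels-sym n (U _) (U _) = refl
labels-sym n (U _) (V _) = refl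
labels-sym n (V _) A     = refl
labels-sym n (V _) B     = refl
labels-sym n (V _) (U _) = refl
labels-sym n (V _) (V _) = refl

tAB-labels-unique : ∀ n → Unique (applyUpTo tAB n)
tAB-labels-unique n = Unique.applyUpTo⁺₁ tAB n (λ i<j _ → <⇒≢ i<j ∘ tAB-injective)

labels-unique : ∀ n k k′ → Unique (labels n k k′)
labels-unique n A     A     = []
labels-unique n A     B     = tAB-labels-unique n
labels-unique n A     (U _) = [] ∷ []
labels-unique n A     (V _) = []
labels-unique n B     A     = tAB-labels-unique n
labels-unique n B     B     = []
labels-unique n B     (U _) = []
labels-unique n B     (V _) = [] ∷ []
labels-unique n (U _) A     = [] ∷ []
labels-unique n (U _) B     = []
labels-unique n (U _) (U _) = []
labels-unique n (U _) (V _) = []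
labels-unique n (V _) A     = []
labels-unique n (V _) B     = [] ∷ []
labels-unique n (V _) (U _) = []
labels-unique n (V _) (V _) = []

labels-irrefl : ∀ n k → ¬ (not (null (labels n k k)) ≡ true)
labels-irrefl n A     ()
labels-irrefl n B     ()
labels-irrefl n (U _) ()
labels-irrefl n (V _) ()

∈⇒nonempty : ∀ {A : Set} {x : A} {xs} → x ∈ xs → not (null xs) ≡ true
∈⇒nonempty (here _)  = refl
∈⇒nonempty (there _) = refl

G₀ : (n : ℕ) → TemporalGraph n
G₀ n = record
  { adj        = λ x y → not (null (labels n (kindOf x) (kindOf y)))
  ; adj-sym    = λ x y → cong (not ∘ null) (labels-sym n (kindOf x) (kindOf y))
  ; adj-irrefl = λ x → labels-irrefl n (kindOf x)
  ; label      = λ x y → labels n (kindOf x) (kindOf y)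
  ; label-sym  = λ x y → labels-sym n (kindOf x) (kindOf y)
  ; label-uniq = λ x y → labels-unique n (kindOf x) (kindOf y)
  ; label-pos  = λ x y → All.tabulate (Edge⇒0< ∘ ∈⇒Edge (kindOf x) (kindOf y))
  }

Edge⇒Hop₀ : ∀ {n k k′ τ} (k<n : code k < n) (k′<n : code k′ < n) →
            Edge n k k′ τ → Hop (G₀ n) (vertex k k<n) (vertex k′ k′<n) τ
Edge⇒Hop₀ {n} {k} {k′} {τ} k<n k′<n e = hop (∈⇒nonempty mem) mem
  where
  mem : τ ∈ label (G₀ n) (vertex k k<n) (vertex k′ k′<n)
  mem = subst₂ (λ k k′ → τ ∈ labels n k k′) (sym (kindOf-vertex k k<n)) (sym (kindOf-vertex k′ k′<n))
               (Edge⇒∈ e)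

-- The graph G₀ realizes D

arrB-≤ : ∀ k m → arrA k < tAB m → arrB k ≤ tAB m
arrB-≤ A     m _  = tAB-mono-≤ (z≤n {m})
arrB-≤ B     _ _  = z≤n
arrB-≤ (U j) m lt = tAB-mono-≤ (time<tAB⇒≤ j m 1 lt)
arrB-≤ (V j) _ lt = <⇒≤ (<-trans (tV<tAB j) lt)

arrA-≤ : ∀ k m → arrB k < tAB m → arrA k ≤ tAB m
arrA-≤ A     _ _  = z≤n
arrA-≤ B     m _  = tAB-mono-≤ (z≤n {m})
arrA-≤ (U j) _ lt = <⇒≤ (<-trans (tU<tAB j) lt)
arrA-≤ (V j) m lt = tAB-mono-≤ (time<tAB⇒≤ j m 2 lt)

DK-edge : ∀ {n k k′ τ} → Edge n k k′ τ → DK k k′ ≤∞ τ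
DK-edge (ab {m} _) = tAB-mono-≤ (z≤n {m})
DK-edge (ba {m} _) = tAB-mono-≤ (z≤n {m})
DK-edge (au _)     = after-reached z<s
DK-edge (ua _)     = ≤-refl
DK-edge (bv _)     = after-reached z<s
DK-edge (vb _)     = ≤-refl

DK-step : ∀ {n} k {k₁ k₂ lo τ} → Edge n k₁ k₂ τ → DK k k₁ ≤∞ lo → lo < τ → DK k k₂ ≤∞ τ
DK-step k (ab {m} _) h lo<τ = arrB-≤ k m (≤-<-trans h lo<τ)
DK-step k (ba {m} _) h lo<τ = arrA-≤ k m (≤-<-trans h lo<τ)
DK-step k (au _)     h lo<τ = after-reached (≤-<-trans h lo<τ)
DK-step k (ua _)     h lo<τ = ⊥-elim (<⇒≱ lo<τ (proj₂ (after-≤∞ h)))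
DK-step k (bv _)     h lo<τ = after-reached (≤-<-trans h lo<τ)
DK-step k (vb _)     h lo<τ = ⊥-elim (<⇒≱ lo<τ (proj₂ (after-≤∞ h)))

D-closed : ∀ {n} (s : Fin n) → Closed (G₀ n) (D n s)
D-closed {n} s {x} {y} mem h lo<τ with s ≟ y | s ≟ x
... | yes refl | _        = z≤n
... | no _     | yes refl = DK-edge (∈⇒Edge {n} (kindOf s) (kindOf y) mem)
... | no _     | no _     = DK-step (kindOf s) (∈⇒Edge {n} (kindOf x) (kindOf y) mem) h lo<τ

module _ {n : ℕ} where

  path₁₀ : ∀ {k₁ k₂ τ} (p₁ : code k₁ < n) (p₂ : code k₂ < n) →
           Edge n k₁ k₂ τ → StrictTPath (G₀ n) (vertex k₁ p₁) (vertex k₂ p₂) τ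
  path₁₀ p₁ p₂ e = path₁ _ (Edge⇒Hop₀ p₁ p₂ e)

  path₂₀ : ∀ {k₁ k₂ k₃ τ₁ τ₂} (p₁ : code k₁ < n) (p₂ : code k₂ < n) (p₃ : code k₃ < n) →
           k₁ ≢ k₃ → Edge n k₁ k₂ τ₁ → Edge n k₂ k₃ τ₂ → τ₁ < τ₂ →
           StrictTPath (G₀ n) (vertex k₁ p₁) (vertex k₃ p₃) τ₂
  path₂₀ {k₁} {k₂} {k₃} p₁ p₂ p₃ k₁≢k₃ e₁ e₂ =
    path₂ _ (vertex-≢ {k = k₁} {k₃} {p₁} {p₃} k₁≢k₃) (Edge⇒Hop₀ p₁ p₂ e₁) (Edge⇒Hop₀ p₂ p₃ e₂)

  path₃₀ : ∀ {k₁ k₂ k₃ k₄ τ₁ τ₂ τ₃}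
           (p₁ : code k₁ < n) (p₂ : code k₂ < n) (p₃ : code k₃ < n) (p₄ : code k₄ < n) →
           k₁ ≢ k₃ → k₁ ≢ k₄ → k₂ ≢ k₄ →
           Edge n k₁ k₂ τ₁ → Edge n k₂ k₃ τ₂ → Edge n k₃ k₄ τ₃ → τ₁ < τ₂ → τ₂ < τ₃ →
           StrictTPath (G₀ n) (vertex k₁ p₁) (vertex k₄ p₄) τ₃
  path₃₀ {k₁} {k₂} {k₃} {k₄} p₁ p₂ p₃ p₄ k₁≢k₃ k₁≢k₄ k₂≢k₄ e₁ e₂ e₃ =
    path₃ _ (vertex-≢ {k = k₁} {k₃} {p₁} {p₃} k₁≢k₃) (vertex-≢ {k = k₁} {k₄} {p₁} {p₄} k₁≢k₄)
      (vertex-≢ {k = k₂} {k₄} {p₂} {p₄} k₂≢k₄)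
      (Edge⇒Hop₀ p₁ p₂ e₁) (Edge⇒Hop₀ p₂ p₃ e₂) (Edge⇒Hop₀ p₃ p₄ e₃)

  private
    a< : ∀ {m} → m < n → code A < n
    a< = ≤-<-trans z≤n

    b< : ∀ {m} → suc m < n → code B < n
    b< = ≤-<-trans (s≤s z≤n)

    round<n : ∀ j → code (U j) < n → j < n
    round<n j = <-trans (index<code-U j)

  DK-path : ∀ {k k′ t} (p : code k < n) (q : code k′ < n) → k ≢ k′ →
            DK k k′ ≡ fin t → StrictTPath (G₀ n) (vertex k p) (vertex k′ q) t
  DK-path {A} {A} _ _ A≢A _ = ⊥-elim (A≢A refl)
  DK-path {B} {B} _ _ B≢B _ = ⊥-elim (B≢B refl)
  DK-path {A} {B} p q _ refl = path₁₀ p q (ab p)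
  DK-path {A} {U j} p q _ eq with after-fin 0 (tU j) eq
  ... | _ , refl = path₁₀ p q (au j)
  DK-path {A} {V j} p q _ eq with after-fin (tAB 0) (tV j) eq
  ... | lt , refl = path₂₀ p (b< q) q (λ ()) (ab p) (bv j) lt
  DK-path {B} {A} p q _ refl = path₁₀ p q (ba q)
  DK-path {B} {U j} p q _ eq with after-fin (tAB 0) (tU j) eq
  ... | lt , refl = path₂₀ p (a< p) q (λ ()) (ba (a< p)) (au j) lt
  DK-path {B} {V j} p q _ eq with after-fin 0 (tV j) eq
  ... | _ , refl = path₁₀ p q (bv j)
  DK-path {U j} {A} p q _ refl = path₁₀ p q (ua j)
  DK-path {U j} {B} p q _ refl =
    path₂₀ p (a< p) q (λ ()) (ua j) (ab (round<n j p)) (tU<tAB j)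
  DK-path {U i} {U j} p q U≢U eq with after-fin (tU i) (tU j) eq
  ... | lt , refl = path₂₀ p (a< p) q U≢U (ua i) (au j) lt
  DK-path {U i} {V j} p q _ eq with after-fin (tAB i) (tV j) eq
  ... | lt , refl =
    path₃₀ p (a< p) (b< q) q (λ ()) (λ ()) (λ ()) (ua i) (ab (round<n i p)) (bv j) (tU<tAB i) lt
  DK-path {V j} {A} p q _ refl =
    path₂₀ p (b< p) q (λ ()) (vb j) (ba (round<n j (<-trans (n<1+n _) p))) (tV<tAB j)
  DK-path {V j} {B} p q _ refl = path₁₀ p q (vb j)
  DK-path {V i} {U j} p q _ eq with after-fin (tAB i) (tU j) eq
  ... | lt , refl =
    path₃₀ p (b< p) (a< p) q (λ ()) (λ ()) (λ ())
      (vb i) (ba (round<n i (<-trans (n<1+n _) p))) (au j) (tV<tAB i) lt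
  DK-path {V i} {V j} p q V≢V eq with after-fin (tV i) (tV j) eq
  ... | lt , refl = path₂₀ p (b< p) q V≢V (vb i) (bv j) lt

G₀-realizes : ∀ n → IsFo (G₀ n) (D n)
G₀-realizes n = IsFo-intro (G₀ n) D-diag D-closed path
  where
  path : ∀ {u v t} → u ≢ v → D n u v ≡ fin t → StrictTPath (G₀ n) u v t
  path {u} {v} u≢v eq =
    subst₂ (λ x y → StrictTPath (G₀ n) x y _) (vertex-kindOf u) (vertex-kindOf v)
      (DK-path (code-kindOf< u) (code-kindOf< v) (u≢v ∘ kindOf-injective)
        (trans (sym (D-off u≢v)) eq))

-- Labels forced in every realization

V-row-≥ : ∀ {j} k {a} → DK (V j) k ≤∞ a → tV j ≤ a
V-row-≥ {j} A     h = ≤-trans (<⇒≤ (tV<tAB j)) h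
V-row-≥     B     h = h
V-row-≥ {j} (U _) h = let lt , le = after-≤∞ h in <⇒≤ (<-trans (tV<tAB j) (<-≤-trans lt le))
V-row-≥     (V _) h = let lt , le = after-≤∞ h in <⇒≤ (<-≤-trans lt le)

U-row : ∀ {j} k {a} → DK (U j) k ≤∞ a → k ≡ A ⊎ tAB j ≤ a
U-row     A     _ = inj₁ refl
U-row     B     h = inj₂ h
U-row {i} (U j) h = let lt , le = after-≤∞ h in inj₂ (<⇒≤ (<-≤-trans (tU<tU⇒tAB<tU i j lt) le))
U-row     (V _) h = let lt , le = after-≤∞ h in inj₂ (<⇒≤ (<-≤-trans lt le))

module _ {n : ℕ} (G : TemporalGraph n) (fo : IsFo G (D n)) where

  vb-hop-forced : ∀ {j} {b v : Fin n} → kindOf b ≡ B → kindOf v ≡ V j → Hop G v b (tV j)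
  vb-hop-forced {j} {b} {v} kb kv with foremost-last-hop G fo v≢b (D-between v≢b kv kb)
    where
    v≢b : v ≢ b
    v≢b = kind-≢ kv kb λ ()
  ... | inj₁ last-hop = last-hop
  ... | inj₂ (w , v≢w , _ , a , a<t , bound) =
    ⊥-elim (<⇒≱ a<t (V-row-≥ (kindOf w) (subst (_≤∞ a) (D-between v≢w kv refl) bound)))

  -- Through b, the vertex v would reach u, whereas D v u = ∞.
  ub-hop-impossible : ∀ {j} {b u v : Fin n} → kindOf b ≡ B → kindOf u ≡ U j → kindOf v ≡ V j →
                      ¬ Hop G u b (tAB j)
  ub-hop-impossible {j} {b} {u} {v} kb ku kv ub =
    <-asym (tU<tAB j) (proj₁ (after-≤∞ (subst (_≤∞ tAB j) (D-between v≢u kv ku) v⇝u)))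
    where
    v≢u : v ≢ u
    v≢u = kind-≢ kv ku λ ()
    v⇝u : D n v u ≤∞ tAB j
    v⇝u = IsFo⇒bound G fo v≢u (path₂ G v≢u (vb-hop-forced kb kv) (Hop-sym G ub) (tV<tAB j))

  ab-hop-forced : ∀ {j} {a b u v : Fin n} →
    kindOf a ≡ A → kindOf b ≡ B → kindOf u ≡ U j → kindOf v ≡ V j → Hop G a b (tAB j)
  ab-hop-forced {j} {a} {b} {u} {v} ka kb ku kv with foremost-last-hop G fo u≢b (D-between u≢b ku kb)
    where
    u≢b : u ≢ b
    u≢b = kind-≢ ku kb λ ()
  ... | inj₁ ub = ⊥-elim (ub-hop-impossible {v = v} kb ku kv ub)
  ... | inj₂ (w , u≢w , last-hop , t , t<tAB , bound)
    with U-row (kindOf w) (subst (_≤∞ t) (D-between u≢w ku refl) bound)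
  ...   | inj₁ kw = subst (λ x → Hop G x b (tAB j)) (kindOf-injective (trans kw (sym ka))) last-hop
  ...   | inj₂ tAB≤t = ⊥-elim (<⇒≱ t<tAB tAB≤t)

code-V< : ∀ {m j} → j < ⌊ m /2⌋ → code (V j) < 2 + m
code-V< {0}           ()
code-V< {1}           ()
code-V< {suc (suc m)} {zero}  _          = s≤s (s≤s (s≤s (s≤s z≤n)))
code-V< {suc (suc m)} {suc j} (s≤s j<r) = s≤s (s≤s (code-V< j<r))

6+k≤4*⌊4+k/2⌋ : ∀ k → 6 + k ≤ 4 * ⌊ 4 + k /2⌋
6+k≤4*⌊4+k/2⌋ 0             = m≤m+n 6 2
6+k≤4*⌊4+k/2⌋ 1             = n≤1+n 7
6+k≤4*⌊4+k/2⌋ (suc (suc k)) = begin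
  8 + k                      ≤⟨ +-monoʳ-≤ 2 (6+k≤4*⌊4+k/2⌋ k) ⟩
  2 + 4 * ⌊ 4 + k /2⌋        ≤⟨ +-monoˡ-≤ (4 * ⌊ 4 + k /2⌋) (m≤m+n 2 2) ⟩
  4 + 4 * ⌊ 4 + k /2⌋        ≡⟨ *-suc 4 ⌊ 4 + k /2⌋ ⟨
  4 * ⌊ 6 + k /2⌋            ∎
  where open ≤-Reasoning

long-ab-edge : ∀ {n} → 6 ≤ n → (G : TemporalGraph n) → IsFo G (D n) →
  ∃[ u ] ∃[ v ] (adj G u v ≡ true × n ≤ 4 * length (label G u v))
long-ab-edge (s≤s (s≤s (s≤s (s≤s (s≤s (s≤s (z≤n {k}))))))) G fo =
  zero , suc zero , Hop.adjacent (forced (s≤s z≤n)) , (begin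
    6 + k                                   ≤⟨ 6+k≤4*⌊4+k/2⌋ k ⟩
    4 * ⌊ 4 + k /2⌋                         ≤⟨ *-monoʳ-≤ 4 (injective-members⇒≤length _ tAB-injective
                                                 (Hop.labelled ∘ forced)) ⟩
    4 * length (label G zero (suc zero))    ∎)
  where
  open ≤-Reasoning
  forced : ∀ {j} → j < ⌊ 4 + k /2⌋ → Hop G zero (suc zero) (tAB j)
  forced {j} j<r = ab-hop-forced G fo {u = vertex (U j) u<n} {v = vertex (V j) v<n} refl refl
    (kindOf-vertex (U j) u<n) (kindOf-vertex (V j) v<n)
    where
    v<n : code (V j) < 6 + k
    v<n = code-V< j<r
    u<n : code (U j) < 6 + k
    u<n = <-trans (n<1+n _) v<n

proposition3p3 : Σ ((n : ℕ) → Matrix n) λ D →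
    ((n : ℕ) → 1 ≤ n → IsDistanceMatrix n (D n) × FoRealizable n (D n)) ×
    (∃[ c ] (0 < c × ∃[ N ] ((n : ℕ) → N ≤ n → 1 ≤ n →
    (G : TemporalGraph n) → IsFo G (D n) →
    ∃[ u ] ∃[ v ] (adj G u v ≡ true × n ≤ c * length (label G u v)))))
proposition3p3 =
  D , (λ n _ → D-isDistanceMatrix n , G₀ n , G₀-realizes n) ,
  4 , z<s , 6 , λ _ 6≤n _ → long-ab-edge 6≤n
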